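{- Let $\Delta$ be a flag weak $3$-pseudomanifold on $n$ vertices. Then for any facet $\sigma=\{v_1,v_2,v_3,v_4\}$ of $\Delta$, \[\sum_{e\subseteq\sigma,\ |e|=2} f_0(\mathrm{lk}_\Delta e)\leq n+16,\] the sum being over the six edges of $\sigma$. If equality holds, then $\bigcup_{w\in\tau}V(\mathrm{lk}_\Delta w)=V(\Delta)$ for every ridge (2-face) $\tau\subseteq\sigma$.
   Context: A simplicial complex is flag if every minimal non-face has exactly two elements. A weak $3$-pseudomanifold is a pure $3$-dimensional simplicial complex in which every $2$-face lies in exactly two facets. For a face $\tau$, $\mathrm{lk}_\Delta\tau=\{\rho-\tau:\tau\subseteq\rho\in\Delta\}$; $V(\cdot)$ is the vertex set and $f_0(\cdot)$ the number of vertices. -}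

module Defs where

open import Data.Nat using (ℕ; _+_; _≤_)
open import Data.Bool using (Bool; true; false; T; not; _∧_)
open import Data.Fin using (Fin)
open import Data.Fin.Subset using (Subset; _∈_; _∉_; _⊆_; _⊂_; _∪_; ⁅_⁆; ∣_∣)
open import Data.Vec using (lookup; tabulate)
open import Data.Product using (Σ; _×_; ∃)
open import Data.Sum using (_⊎_)
open import Relation.Binary.PropositionalEquality using (_≡_; _≢_)
open import Relation.Nullary using (¬_)

-- Faces are subsets of Fin n, given by a Boolean membership test, closed
-- under taking subsets, and every vertex {v} is a face (so V(Δ) = Fin n,
-- i.e. Δ has exactly n vertices).
record SimplicialComplex (n : ℕ) : Set where
  field
    face       : Subset n → Bool
    down-closed : ∀ {σ τ} → σ ⊆ τ → T (face τ) → T (face σ)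
    vertex     : ∀ (v : Fin n) → T (face ⁅ v ⁆)

module _ {n : ℕ} (Δ : SimplicialComplex n) where
  open SimplicialComplex Δ

  Face : Subset n → Set
  Face σ = T (face σ)

  IsFacet : Subset n → Set
  IsFacet σ = Face σ × (∀ τ → Face τ → σ ⊆ τ → τ ≡ σ)

  IsMinimalNonFace : Subset n → Set
  IsMinimalNonFace S = ¬ Face S × (∀ T′ → T′ ⊂ S → Face T′)

  IsFlag : Set
  IsFlag = ∀ S → IsMinimalNonFace S → ∣ S ∣ ≡ 2

  IsPure3 : Set
  IsPure3 = (∀ σ → Face σ → ∣ σ ∣ ≤ 4)
          × (∀ σ → Face σ → Σ (Subset n) λ ρ → Face ρ × σ ⊆ ρ × ∣ ρ ∣ ≡ 4)

  IsWeak3Pseudomanifold : Set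
  IsWeak3Pseudomanifold =
    IsPure3 ×
    (∀ τ → Face τ → ∣ τ ∣ ≡ 3 →
      Σ (Subset n) λ ρ₁ → Σ (Subset n) λ ρ₂ →
        (Face ρ₁ × τ ⊆ ρ₁ × ∣ ρ₁ ∣ ≡ 4) ×
        (Face ρ₂ × τ ⊆ ρ₂ × ∣ ρ₂ ∣ ≡ 4) ×
        ρ₁ ≢ ρ₂ ×
        (∀ ρ → Face ρ → τ ⊆ ρ → ∣ ρ ∣ ≡ 4 → (ρ ≡ ρ₁ ⊎ ρ ≡ ρ₂)))

  linkVertices : Subset n → Subset n
  linkVertices τ = tabulate λ w → not (lookup τ w) ∧ face (τ ∪ ⁅ w ⁆)

  f₀lk : Subset n → ℕ
  f₀lk τ = ∣ linkVertices τ ∣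

pair : ∀ {n} → Fin n → Fin n → Subset n
pair a b = ⁅ a ⁆ ∪ ⁅ b ⁆

quad : ∀ {n} → Fin n → Fin n → Fin n → Fin n → Subset n
quad a b c d = ⁅ a ⁆ ∪ ⁅ b ⁆ ∪ ⁅ c ⁆ ∪ ⁅ d ⁆

module Submission where

-- Proof by double counting.  Write σ = {v₁,v₂,v₃,v₄} and, for a vertex u,
--   c(u) = #{ edges e ⊆ σ : u ∈ V(lk e) },   so that   S = Σ_u c(u),
--   D(u) = [u ∈ σ] + #{ ridges τ ⊆ σ : u ∉ σ and {u} ∪ τ ∈ Δ }.
-- (1) Local bound c(u) ≤ 1 + 2·D(u).  If u ∈ σ, u lies in three of the six
--     edges, so c(u) ≤ 3, while D(u) ≥ 1.  If u ∉ σ and u ∈ V(lk{a,b}) then u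
--     is adjacent to a and b; by flagness u cones off every ridge of σ all of
--     whose vertices it is adjacent to.  With k neighbours of u in σ this gives
--     c(u) ≤ C(k,2) ≤ 1 + 2·C(k,3) ≤ 1 + 2·D(u).
-- (2) Global bound Σ_u D(u) ≤ 4 + 4: in a weak 3-pseudomanifold a ridge of σ
--     lies in exactly two facets, one of them σ, so it has at most one apex u ∉ σ.
-- Summing (1) and using (2): S ≤ n + 16.  If S = n + 16, no u can have
-- c(u) = 0 (the sum would drop strictly), so every u ∉ σ lies in the link of
-- an edge of σ; a ridge τ ⊆ σ meets that edge, and for u ∈ σ any other vertex
-- of τ works.

open import Defs
open import Data.Bool using (Bool; true; false; T; not; _∧_)
open import Data.Bool.Properties using (T-≡; T-∧; T-not-≡)
open import Data.Empty using (⊥; ⊥-elim)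
open import Data.Fin using (Fin; zero; suc)
open import Data.Fin.Properties using (_≟_; any?; 0≢1+n) renaming (suc-injective to Fin-suc-injective)
open import Data.Fin.Subset using (Subset; _∈_; _∉_; _⊆_; _⊂_; _∪_; ⁅_⁆; ∣_∣; _-_)
open import Data.Fin.Subset.Properties
  using (_∈?_; x∈⁅x⁆; x∈⁅y⁆⇒x≡y; x≢y⇒x∉⁅y⁆; ∣⁅x⁆∣≡1; p⊆p∪q; q⊆p∪q; x∈p∪q⁻; ∪-identityˡ;
         p⊆q⇒∣p∣≤∣q∣; p⊂q⇒∣p∣<∣q∣; x∈p∧x≢y⇒x∈p-y; x∈p⇒∣p-x∣<∣p∣)
open import Data.Nat using (ℕ; zero; suc; pred; _+_; _≤_; _<_; z≤n; s≤s)
open import Data.Nat.Properties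
  using (≤-refl; ≤-reflexive; ≤-trans; ≤-pred; +-mono-≤; +-monoʳ-≤; +-mono-<-≤; +-mono-≤-<;
         m≤m+n; m≤n+m; ≤ᵇ⇒≤; <⇒≱; <-irrefl; n≮0; +-0-commutativeMonoid; module ≤-Reasoning)
open import Algebra.Properties.CommutativeMonoid.Sum +-0-commutativeMonoid using (sum; ∑-distrib-+)
open import Data.Product using (Σ; _×_; _,_; proj₁; proj₂)
open import Data.Sum using (_⊎_; inj₁; inj₂; [_,_]′; map₁; map₂)
open import Data.Unit using (tt)
open import Data.Vec using (_∷_; lookup; tabulate; here; there)
open import Data.Vec.Properties using (lookup∘tabulate; tabulate∘lookup; []=⇒lookup; lookup⇒[]=)
open import Function using (_∘_; Equivalence)
open import Relation.Binary.PropositionalEquality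
  using (_≡_; _≢_; refl; sym; trans; cong; cong₂; subst; module ≡-Reasoning)
open import Relation.Nullary using (¬_; yes; no; contradiction)
open import Relation.Nullary.Decidable using (T?; _×-dec_; ¬?)

open Equivalence using (to; from)


⟦_⟧ : Bool → ℕ
⟦ true ⟧ = 1
⟦ false ⟧ = 0

⟦⟧≤1 : ∀ b → ⟦ b ⟧ ≤ 1
⟦⟧≤1 true = ≤-refl
⟦⟧≤1 false = z≤n

⟦⟧-false : ∀ {b} → ¬ T b → ⟦ b ⟧ ≡ 0
⟦⟧-false {true} ¬b = ⊥-elim (¬b tt)
⟦⟧-false {false} ¬b = refl

⟦⟧-mono : ∀ {a b} → (T a → T b) → ⟦ a ⟧ ≤ ⟦ b ⟧
⟦⟧-mono {false} a⇒b = z≤n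
⟦⟧-mono {true} {true} a⇒b = ≤-refl
⟦⟧-mono {true} {false} a⇒b = ⊥-elim (a⇒b tt)

sum-mono : ∀ {n} {g h : Fin n → ℕ} → (∀ u → g u ≤ h u) → sum g ≤ sum h
sum-mono {zero} g≤h = z≤n
sum-mono {suc n} g≤h = +-mono-≤ (g≤h zero) (sum-mono (g≤h ∘ suc))

sum-mono-< : ∀ {n} (g h : Fin n → ℕ) → (∀ u → g u ≤ h u) → ∀ u₀ → g u₀ < h u₀ → sum g < sum h
sum-mono-< {suc n} g h g≤h zero g₀<h₀ = +-mono-<-≤ g₀<h₀ (sum-mono (g≤h ∘ suc))
sum-mono-< {suc n} g h g≤h (suc u₀) gᵤ<hᵤ =
  +-mono-≤-< (g≤h zero) (sum-mono-< (g ∘ suc) (h ∘ suc) (g≤h ∘ suc) u₀ gᵤ<hᵤ)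

sum-ones : ∀ n → sum {n} (λ _ → 1) ≡ n
sum-ones zero = refl
sum-ones (suc n) = cong suc (sum-ones n)

∣tabulate∣ : ∀ {n} (f : Fin n → Bool) → ∣ tabulate f ∣ ≡ sum (λ u → ⟦ f u ⟧)
∣tabulate∣ {zero} f = refl
∣tabulate∣ {suc n} f with f zero
... | true = cong suc (∣tabulate∣ (f ∘ suc))
... | false = ∣tabulate∣ (f ∘ suc)

∣p∣≡sum : ∀ {n} (p : Subset n) → ∣ p ∣ ≡ sum (λ u → ⟦ lookup p u ⟧)
∣p∣≡sum p = trans (cong ∣_∣ (sym (tabulate∘lookup p))) (∣tabulate∣ (lookup p))

sum-none : ∀ {n} (f : Fin n → Bool) → (∀ u → ¬ T (f u)) → sum (λ u → ⟦ f u ⟧) ≡ 0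
sum-none {zero} f none = refl
sum-none {suc n} f none = cong₂ _+_ (⟦⟧-false (none zero)) (sum-none (f ∘ suc) (none ∘ suc))

sum-at-most-one : ∀ {n} (f : Fin n → Bool) → (∀ {u u′} → T (f u) → T (f u′) → u ≡ u′) →
                  sum (λ u → ⟦ f u ⟧) ≤ 1
sum-at-most-one {zero} f once = z≤n
sum-at-most-one {suc n} f once with T? (f zero)
... | yes f₀ = +-mono-≤ (⟦⟧≤1 (f zero))
                 (≤-reflexive (sum-none (f ∘ suc) (λ u fᵤ → 0≢1+n (once f₀ fᵤ))))
... | no ¬f₀ = +-mono-≤ (≤-reflexive (⟦⟧-false ¬f₀))
                 (sum-at-most-one (f ∘ suc) (λ fᵤ fᵤ′ → Fin-suc-injective (once fᵤ fᵤ′)))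

module _ {n : ℕ} (g₁ g₂ g₃ g₄ : Fin n → ℕ) where
  open ≡-Reasoning

  ∑-distrib₄ : sum (λ u → g₁ u + g₂ u + g₃ u + g₄ u) ≡ sum g₁ + sum g₂ + sum g₃ + sum g₄
  ∑-distrib₄ = begin
    sum (λ u → g₁ u + g₂ u + g₃ u + g₄ u)   ≡⟨ ∑-distrib-+ (λ u → g₁ u + g₂ u + g₃ u) g₄ ⟩
    sum (λ u → g₁ u + g₂ u + g₃ u) + sum g₄ ≡⟨ cong (_+ sum g₄) (∑-distrib-+ (λ u → g₁ u + g₂ u) g₃) ⟩
    sum (λ u → g₁ u + g₂ u) + sum g₃ + sum g₄ ≡⟨ cong (λ s → s + sum g₃ + sum g₄) (∑-distrib-+ g₁ g₂) ⟩
    sum g₁ + sum g₂ + sum g₃ + sum g₄       ∎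

  ∑-distrib₆ : (g₅ g₆ : Fin n → ℕ) →
    sum (λ u → g₁ u + g₂ u + g₃ u + g₄ u + g₅ u + g₆ u)
      ≡ sum g₁ + sum g₂ + sum g₃ + sum g₄ + sum g₅ + sum g₆
  ∑-distrib₆ g₅ g₆ = begin
    sum (λ u → g₁ u + g₂ u + g₃ u + g₄ u + g₅ u + g₆ u)
      ≡⟨ ∑-distrib-+ (λ u → g₁ u + g₂ u + g₃ u + g₄ u + g₅ u) g₆ ⟩
    sum (λ u → g₁ u + g₂ u + g₃ u + g₄ u + g₅ u) + sum g₆
      ≡⟨ cong (_+ sum g₆) (∑-distrib-+ (λ u → g₁ u + g₂ u + g₃ u + g₄ u) g₅) ⟩
    sum (λ u → g₁ u + g₂ u + g₃ u + g₄ u) + sum g₅ + sum g₆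
      ≡⟨ cong (λ s → s + sum g₅ + sum g₆) ∑-distrib₄ ⟩
    sum g₁ + sum g₂ + sum g₃ + sum g₄ + sum g₅ + sum g₆ ∎

+-mono-≤₄ : ∀ {a₁ a₂ a₃ a₄ b₁ b₂ b₃ b₄} → a₁ ≤ b₁ → a₂ ≤ b₂ → a₃ ≤ b₃ → a₄ ≤ b₄ →
            a₁ + a₂ + a₃ + a₄ ≤ b₁ + b₂ + b₃ + b₄
+-mono-≤₄ h₁ h₂ h₃ h₄ = +-mono-≤ (+-mono-≤ (+-mono-≤ h₁ h₂) h₃) h₄

+-mono-≤₆ : ∀ {a₁ a₂ a₃ a₄ a₅ a₆ b₁ b₂ b₃ b₄ b₅ b₆} →
            a₁ ≤ b₁ → a₂ ≤ b₂ → a₃ ≤ b₃ → a₄ ≤ b₄ → a₅ ≤ b₅ → a₆ ≤ b₆ →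
            a₁ + a₂ + a₃ + a₄ + a₅ + a₆ ≤ b₁ + b₂ + b₃ + b₄ + b₅ + b₆
+-mono-≤₆ h₁ h₂ h₃ h₄ h₅ h₆ = +-mono-≤ (+-mono-≤ (+-mono-≤₄ h₁ h₂ h₃ h₄) h₅) h₆

some-true : ∀ b₁ b₂ b₃ b₄ b₅ b₆ → ⟦ b₁ ⟧ + ⟦ b₂ ⟧ + ⟦ b₃ ⟧ + ⟦ b₄ ⟧ + ⟦ b₅ ⟧ + ⟦ b₆ ⟧ ≢ 0 →
            T b₁ ⊎ T b₂ ⊎ T b₃ ⊎ T b₄ ⊎ T b₅ ⊎ T b₆
some-true true _ _ _ _ _ _ = inj₁ tt
some-true false true _ _ _ _ _ = inj₂ (inj₁ tt)
some-true false false true _ _ _ _ = inj₂ (inj₂ (inj₁ tt))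
some-true false false false true _ _ _ = inj₂ (inj₂ (inj₂ (inj₁ tt)))
some-true false false false false true _ _ = inj₂ (inj₂ (inj₂ (inj₂ (inj₁ tt))))
some-true false false false false false true _ = inj₂ (inj₂ (inj₂ (inj₂ (inj₂ tt))))
some-true false false false false false false ≢0 = contradiction refl ≢0

choose₂ choose₃ : Bool → Bool → Bool → Bool → ℕ
choose₂ x₁ x₂ x₃ x₄ =
  ⟦ x₁ ∧ x₂ ⟧ + ⟦ x₁ ∧ x₃ ⟧ + ⟦ x₁ ∧ x₄ ⟧ + ⟦ x₂ ∧ x₃ ⟧ + ⟦ x₂ ∧ x₄ ⟧ + ⟦ x₃ ∧ x₄ ⟧
choose₃ x₁ x₂ x₃ x₄ =
  ⟦ x₁ ∧ x₂ ∧ x₃ ⟧ + ⟦ x₁ ∧ x₂ ∧ x₄ ⟧ + ⟦ x₁ ∧ x₃ ∧ x₄ ⟧ + ⟦ x₂ ∧ x₃ ∧ x₄ ⟧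

choose₂≤1+2choose₃ : ∀ x₁ x₂ x₃ x₄ →
  choose₂ x₁ x₂ x₃ x₄ ≤ suc (choose₃ x₁ x₂ x₃ x₄ + choose₃ x₁ x₂ x₃ x₄)
choose₂≤1+2choose₃ true  true  true  true  = ≤ᵇ⇒≤ _ _ tt
choose₂≤1+2choose₃ true  true  true  false = ≤ᵇ⇒≤ _ _ tt
choose₂≤1+2choose₃ true  true  false true  = ≤ᵇ⇒≤ _ _ tt
choose₂≤1+2choose₃ true  true  false false = ≤ᵇ⇒≤ _ _ tt
choose₂≤1+2choose₃ true  false true  true  = ≤ᵇ⇒≤ _ _ tt
choose₂≤1+2choose₃ true  false true  false = ≤ᵇ⇒≤ _ _ tt
choose₂≤1+2choose₃ true  false false true  = ≤ᵇ⇒≤ _ _ tt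
choose₂≤1+2choose₃ true  false false false = ≤ᵇ⇒≤ _ _ tt
choose₂≤1+2choose₃ false true  true  true  = ≤ᵇ⇒≤ _ _ tt
choose₂≤1+2choose₃ false true  true  false = ≤ᵇ⇒≤ _ _ tt
choose₂≤1+2choose₃ false true  false true  = ≤ᵇ⇒≤ _ _ tt
choose₂≤1+2choose₃ false true  false false = ≤ᵇ⇒≤ _ _ tt
choose₂≤1+2choose₃ false false true  true  = ≤ᵇ⇒≤ _ _ tt
choose₂≤1+2choose₃ false false true  false = ≤ᵇ⇒≤ _ _ tt
choose₂≤1+2choose₃ false false false true  = ≤ᵇ⇒≤ _ _ tt
choose₂≤1+2choose₃ false false false false = ≤ᵇ⇒≤ _ _ tt

pigeonhole : ∀ {A : Set} {x y z a b : A} →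
             x ≡ a ⊎ x ≡ b → y ≡ a ⊎ y ≡ b → z ≡ a ⊎ z ≡ b → x ≡ y ⊎ x ≡ z ⊎ y ≡ z
pigeonhole (inj₁ refl) (inj₁ refl) _ = inj₁ refl
pigeonhole (inj₂ refl) (inj₂ refl) _ = inj₁ refl
pigeonhole (inj₁ refl) (inj₂ refl) (inj₁ refl) = inj₂ (inj₁ refl)
pigeonhole (inj₁ refl) (inj₂ refl) (inj₂ refl) = inj₂ (inj₂ refl)
pigeonhole (inj₂ refl) (inj₁ refl) (inj₁ refl) = inj₂ (inj₂ refl)
pigeonhole (inj₂ refl) (inj₁ refl) (inj₂ refl) = inj₂ (inj₁ refl)

triangle : ∀ {n} → Fin n → Fin n → Fin n → Subset n
triangle a b c = ⁅ a ⁆ ∪ ⁅ b ⁆ ∪ ⁅ c ⁆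

∣⁅x⁆∪p∣ : ∀ {n} (x : Fin n) p → x ∉ p → ∣ ⁅ x ⁆ ∪ p ∣ ≡ suc ∣ p ∣
∣⁅x⁆∪p∣ zero (false ∷ p) _ = cong (λ q → suc ∣ q ∣) (∪-identityˡ p)
∣⁅x⁆∪p∣ zero (true ∷ p) x∉p = ⊥-elim (x∉p here)
∣⁅x⁆∪p∣ (suc x) (true ∷ p) x∉p = cong suc (∣⁅x⁆∪p∣ x p (x∉p ∘ there))
∣⁅x⁆∪p∣ (suc x) (false ∷ p) x∉p = ∣⁅x⁆∪p∣ x p (x∉p ∘ there)

size-0-empty : ∀ {n} (S : Subset n) → ∣ S ∣ ≡ 0 → ∀ {z} → z ∉ S
size-0-empty (false ∷ S) ∣S∣≡0 (there z∈S) = size-0-empty S ∣S∣≡0 z∈S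

one-element : ∀ {n} (S : Subset n) → ∣ S ∣ ≡ 1 → Σ (Fin n) λ x → x ∈ S × S ⊆ ⁅ x ⁆
one-element (true ∷ S) ∣S∣≡1 =
  zero , here , λ { here → here ; (there z∈S) → ⊥-elim (size-0-empty S (cong pred ∣S∣≡1) z∈S) }
one-element (false ∷ S) ∣S∣≡1 with one-element S ∣S∣≡1
... | x , x∈S , S⊆x = suc x , there x∈S , λ { (there z∈S) → there (S⊆x z∈S) }

two-elements : ∀ {n} (S : Subset n) → ∣ S ∣ ≡ 2 →
               Σ (Fin n) λ x → Σ (Fin n) λ y → x ∈ S × y ∈ S × S ⊆ pair x y
two-elements (true ∷ S) ∣S∣≡2 with one-element S (cong pred ∣S∣≡2)
... | y , y∈S , S⊆y =
  zero , suc y , here , there y∈S , λ { here → here ; (there z∈S) → there (q⊆p∪q _ ⁅ y ⁆ (S⊆y z∈S)) }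
two-elements (false ∷ S) ∣S∣≡2 with two-elements S ∣S∣≡2
... | x , y , x∈S , y∈S , S⊆xy = suc x , suc y , there x∈S , there y∈S , λ { (there z∈S) → there (S⊆xy z∈S) }

module _ {n : ℕ} where
  private variable
    a b c d x y : Fin n
    p S σ τ : Subset n

  lookup-∉ : x ∉ p → lookup p x ≡ false
  lookup-∉ {x} {p} x∉p with lookup p x in eq
  ... | false = refl
  ... | true = ⊥-elim (x∉p (lookup⇒[]= x p eq))

  ∉-lookup : lookup p x ≡ false → x ∉ p
  ∉-lookup eq x∈p with trans (sym ([]=⇒lookup x∈p)) eq
  ... | ()

  ⟦lookup⟧-∈ : x ∈ p → ⟦ lookup p x ⟧ ≡ 1
  ⟦lookup⟧-∈ x∈p rewrite []=⇒lookup x∈p = refl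

  ∉⇒≢ : x ∉ p → y ∈ p → x ≢ y
  ∉⇒≢ x∉p y∈p refl = x∉p y∈p

  ∉∧⁻ : ∀ {b} → T (not (lookup p x) ∧ b) → x ∉ p × T b
  ∉∧⁻ t with to T-∧ t
  ... | x∉p , b = ∉-lookup (to T-not-≡ x∉p) , b

  ∉∧⁺ : ∀ {b} → x ∉ p → T b → T (not (lookup p x) ∧ b)
  ∉∧⁺ x∉p b = from T-∧ (from T-not-≡ (lookup-∉ x∉p) , b)

  ∈-tabulate⁺ : ∀ {f : Fin n → Bool} → T (f x) → x ∈ tabulate f
  ∈-tabulate⁺ {x} {f} t = lookup⇒[]= x (tabulate f) (trans (lookup∘tabulate f x) (to T-≡ t))

  ∈-insert⁻ : x ∈ ⁅ a ⁆ ∪ p → x ≡ a ⊎ x ∈ p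
  ∈-insert⁻ {a = a} {p} = map₁ (x∈⁅y⁆⇒x≡y a) ∘ x∈p∪q⁻ ⁅ a ⁆ p

  ∈-insert : a ∈ ⁅ a ⁆ ∪ p
  ∈-insert {a} {p} = p⊆p∪q p (x∈⁅x⁆ a)

  ∈-pair⁻ : x ∈ pair a b → x ≡ a ⊎ x ≡ b
  ∈-pair⁻ {b = b} = map₂ (x∈⁅y⁆⇒x≡y b) ∘ ∈-insert⁻

  ∈-pairʳ : b ∈ pair a b
  ∈-pairʳ {b} {a} = q⊆p∪q ⁅ a ⁆ ⁅ b ⁆ (x∈⁅x⁆ b)

  ∈-triangle⁻ : x ∈ triangle a b c → x ≡ a ⊎ x ≡ b ⊎ x ≡ c
  ∈-triangle⁻ = map₂ ∈-pair⁻ ∘ ∈-insert⁻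

  ∈-quad⁻ : x ∈ quad a b c d → x ≡ a ⊎ x ≡ b ⊎ x ≡ c ⊎ x ≡ d
  ∈-quad⁻ = map₂ ∈-triangle⁻ ∘ ∈-insert⁻

  pair-⊆ : a ∈ S → b ∈ S → pair a b ⊆ S
  pair-⊆ a∈S b∈S x∈ with ∈-pair⁻ x∈
  ... | inj₁ refl = a∈S
  ... | inj₂ refl = b∈S

  triangle-⊆ : a ∈ S → b ∈ S → c ∈ S → triangle a b c ⊆ S
  triangle-⊆ a∈S b∈S c∈S x∈ with ∈-triangle⁻ x∈
  ... | inj₁ refl = a∈S
  ... | inj₂ (inj₁ refl) = b∈S
  ... | inj₂ (inj₂ refl) = c∈S

  ∉-pair : x ≢ a → x ≢ b → x ∉ pair a b
  ∉-pair x≢a x≢b = [ x≢a , x≢b ]′ ∘ ∈-pair⁻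

  ∉-triangle : x ≢ a → x ≢ b → x ≢ c → x ∉ triangle a b c
  ∉-triangle x≢a x≢b x≢c = [ x≢a , ∉-pair x≢b x≢c ]′ ∘ ∈-insert⁻

  ∣pair∣ : a ≢ b → ∣ pair a b ∣ ≡ 2
  ∣pair∣ {a} {b} a≢b = trans (∣⁅x⁆∪p∣ a ⁅ b ⁆ (x≢y⇒x∉⁅y⁆ a≢b)) (cong suc (∣⁅x⁆∣≡1 b))

  ∣triangle∣ : a ≢ b → a ≢ c → b ≢ c → ∣ triangle a b c ∣ ≡ 3
  ∣triangle∣ {a} {b} {c} a≢b a≢c b≢c =
    trans (∣⁅x⁆∪p∣ a (pair b c) (∉-pair a≢b a≢c)) (cong suc (∣pair∣ b≢c))

  ∣quad∣ : a ≢ b → a ≢ c → a ≢ d → b ≢ c → b ≢ d → c ≢ d → ∣ quad a b c d ∣ ≡ 4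
  ∣quad∣ {a} {b} {c} {d} a≢b a≢c a≢d b≢c b≢d c≢d =
    trans (∣⁅x⁆∪p∣ a (triangle b c d) (∉-triangle a≢b a≢c a≢d)) (cong suc (∣triangle∣ b≢c b≢d c≢d))

  other-element : 1 < ∣ τ ∣ → ∀ u → Σ (Fin n) λ w → w ∈ τ × w ≢ u
  other-element {τ} 1<∣τ∣ u with any? (λ w → (w ∈? τ) ×-dec ¬? (w ≟ u))
  ... | yes (w , w∈τ , w≢u) = w , w∈τ , w≢u
  ... | no none = ⊥-elim (<⇒≱ 1<∣τ∣ (≤-trans (p⊆q⇒∣p∣≤∣q∣ τ⊆u) (≤-reflexive (∣⁅x⁆∣≡1 u))))
    where
    τ⊆u : τ ⊆ ⁅ u ⁆
    τ⊆u {w} w∈τ with w ≟ u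
    ... | yes refl = x∈⁅x⁆ u
    ... | no w≢u = ⊥-elim (none (w , w∈τ , w≢u))

  meets-pair : τ ⊆ σ → ∣ σ ∣ ≤ suc ∣ τ ∣ → a ∈ σ → b ∈ σ → a ≢ b → a ∈ τ ⊎ b ∈ τ
  meets-pair {τ} {σ} {a} {b} τ⊆σ ∣σ∣≤ a∈σ b∈σ a≢b with a ∈? τ | b ∈? τ
  ... | yes a∈τ | _ = inj₁ a∈τ
  ... | no _ | yes b∈τ = inj₂ b∈τ
  ... | no a∉τ | no b∉τ = ⊥-elim (<-irrefl refl (begin-strict
      suc ∣ τ ∣         ≤⟨ s≤s (p⊆q⇒∣p∣≤∣q∣ τ⊆rest) ⟩
      suc ∣ σ - a - b ∣ ≤⟨ x∈p⇒∣p-x∣<∣p∣ (x∈p∧x≢y⇒x∈p-y b∈σ (a≢b ∘ sym)) ⟩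
      ∣ σ - a ∣         <⟨ x∈p⇒∣p-x∣<∣p∣ a∈σ ⟩
      ∣ σ ∣             ≤⟨ ∣σ∣≤ ⟩
      suc ∣ τ ∣         ∎))
    where
    open ≤-Reasoning
    τ⊆rest : τ ⊆ σ - a - b
    τ⊆rest x∈τ = x∈p∧x≢y⇒x∈p-y (x∈p∧x≢y⇒x∈p-y (τ⊆σ x∈τ) (∉⇒≢ a∉τ x∈τ ∘ sym))
                                (∉⇒≢ b∉τ x∈τ ∘ sym)

module ComplexFacts {n : ℕ} (Δ : SimplicialComplex n) where
  open SimplicialComplex Δ

  private variable
    u u′ w x y : Fin n
    S σ τ : Subset n

  Adjacent : Fin n → Fin n → Set
  Adjacent x y = Face Δ (pair x y)

  adjacent-refl : Adjacent x x
  adjacent-refl {x} = down-closed (pair-⊆ (x∈⁅x⁆ x) (x∈⁅x⁆ x)) (vertex x)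

  adjacent-sym : Adjacent x y → Adjacent y x
  adjacent-sym = down-closed (pair-⊆ ∈-pairʳ ∈-insert)

  Clique : Subset n → Set
  Clique S = ∀ {x y} → x ∈ S → y ∈ S → Adjacent x y

  -- A clique all of whose proper subsets are faces is a face: otherwise it
  -- is a minimal non-face, hence by flagness an edge {x, y}, which is a face.
  clique-minimal : IsFlag Δ → Clique S → (∀ S′ → S′ ⊂ S → Face Δ S′) → Face Δ S
  clique-minimal {S} flag clique proper with T? (face S)
  ... | yes S∈Δ = S∈Δ
  ... | no S∉Δ with two-elements S (flag S (S∉Δ , proper))
  ... | x , y , x∈S , y∈S , S⊆xy = down-closed S⊆xy (clique x∈S y∈S)

  clique-face : IsFlag Δ → Clique S → Face Δ S
  clique-face {S} flag = go ∣ S ∣ S ≤-refl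
    where
    go : ∀ k S → ∣ S ∣ ≤ k → Clique S → Face Δ S
    go zero S ∣S∣≤0 clique = clique-minimal flag clique
      λ S′ S′⊂S → ⊥-elim (n≮0 (≤-trans (p⊂q⇒∣p∣<∣q∣ S′⊂S) ∣S∣≤0))
    go (suc k) S ∣S∣≤k clique = clique-minimal flag clique
      λ S′ S′⊂S → go k S′ (≤-pred (≤-trans (p⊂q⇒∣p∣<∣q∣ S′⊂S) ∣S∣≤k))
                    (λ x∈ y∈ → clique (proj₁ S′⊂S x∈) (proj₁ S′⊂S y∈))

  cone-face : IsFlag Δ → Face Δ τ → (∀ {w} → w ∈ τ → Adjacent u w) → Face Δ (⁅ u ⁆ ∪ τ)
  cone-face {τ} {u} flag τ∈Δ u~τ = clique-face flag clique
    where
    clique : Clique (⁅ u ⁆ ∪ τ)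
    clique x∈ y∈ with ∈-insert⁻ x∈ | ∈-insert⁻ y∈
    ... | inj₁ refl | inj₁ refl = adjacent-refl
    ... | inj₁ refl | inj₂ y∈τ = u~τ y∈τ
    ... | inj₂ x∈τ | inj₁ refl = adjacent-sym (u~τ x∈τ)
    ... | inj₂ x∈τ | inj₂ y∈τ = down-closed (pair-⊆ x∈τ y∈τ) τ∈Δ

  Coface : Subset n → Subset n → Set
  Coface τ ρ = Face Δ ρ × τ ⊆ ρ × ∣ ρ ∣ ≡ 4

  at-most-two-cofaces : IsWeak3Pseudomanifold Δ → Face Δ τ → ∣ τ ∣ ≡ 3 →
                        ∀ {ρ ρ′ ρ″} → Coface τ ρ → Coface τ ρ′ → Coface τ ρ″ →
                        ρ ≡ ρ′ ⊎ ρ ≡ ρ″ ⊎ ρ′ ≡ ρ″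
  at-most-two-cofaces {τ} (_ , ridges) τ∈Δ ∣τ∣≡3 {ρ} {ρ′} {ρ″} (F , ⊆ρ , s) (F′ , ⊆ρ′ , s′) (F″ , ⊆ρ″ , s″)
    with ridges τ τ∈Δ ∣τ∣≡3
  ... | _ , _ , _ , _ , _ , only = pigeonhole (only ρ F ⊆ρ s) (only ρ′ F′ ⊆ρ′ s′) (only ρ″ F″ ⊆ρ″ s″)

  apex-unique : IsWeak3Pseudomanifold Δ → Face Δ σ → ∣ σ ∣ ≡ 4 → τ ⊆ σ → ∣ τ ∣ ≡ 3 →
                u ∉ σ → u′ ∉ σ → Face Δ (⁅ u ⁆ ∪ τ) → Face Δ (⁅ u′ ⁆ ∪ τ) → u ≡ u′
  apex-unique {σ} {τ} {u} {u′} pm σ∈Δ ∣σ∣≡4 τ⊆σ ∣τ∣≡3 u∉σ u′∉σ uτ∈Δ u′τ∈Δ with u ≟ u′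
  ... | yes u≡u′ = u≡u′
  ... | no u≢u′ = ⊥-elim (distinct (at-most-two-cofaces pm (down-closed τ⊆σ σ∈Δ) ∣τ∣≡3
                                      (σ∈Δ , τ⊆σ , ∣σ∣≡4) (apex u∉σ uτ∈Δ) (apex u′∉σ u′τ∈Δ)))
    where
    apex : ∀ {w} → w ∉ σ → Face Δ (⁅ w ⁆ ∪ τ) → Coface τ (⁅ w ⁆ ∪ τ)
    apex {w} w∉σ wτ∈Δ = wτ∈Δ , q⊆p∪q ⁅ w ⁆ τ , trans (∣⁅x⁆∪p∣ w τ (w∉σ ∘ τ⊆σ)) (cong suc ∣τ∣≡3)
    distinct : σ ≡ ⁅ u ⁆ ∪ τ ⊎ σ ≡ ⁅ u′ ⁆ ∪ τ ⊎ ⁅ u ⁆ ∪ τ ≡ ⁅ u′ ⁆ ∪ τ → ⊥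
    distinct (inj₁ refl) = u∉σ ∈-insert
    distinct (inj₂ (inj₁ refl)) = u′∉σ ∈-insert
    distinct (inj₂ (inj₂ eq)) = [ u≢u′ , u∉σ ∘ τ⊆σ ]′ (∈-insert⁻ (subst (u ∈_) eq ∈-insert))

  linkBit : Subset n → Fin n → Bool
  linkBit τ w = not (lookup τ w) ∧ face (τ ∪ ⁅ w ⁆)

  f₀lk≡sum : ∀ τ → f₀lk Δ τ ≡ sum (λ w → ⟦ linkBit τ w ⟧)
  f₀lk≡sum τ = ∣tabulate∣ (linkBit τ)

  link-endpointˡ : ∀ a b → ⟦ linkBit (pair a b) a ⟧ ≤ 0
  link-endpointˡ a b = ≤-reflexive (⟦⟧-false (λ a∈lk → proj₁ (∉∧⁻ {p = pair a b} {x = a} a∈lk) ∈-insert))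

  link-endpointʳ : ∀ a b → ⟦ linkBit (pair a b) b ⟧ ≤ 0
  link-endpointʳ a b = ≤-reflexive (⟦⟧-false (λ b∈lk → proj₁ (∉∧⁻ {p = pair a b} {x = b} b∈lk) ∈-pairʳ))

  link⇒adjacent : T (linkBit τ u) → w ∈ τ → Adjacent u w
  link⇒adjacent {τ} {u} u∈lk w∈τ =
    down-closed (pair-⊆ (q⊆p∪q τ ⁅ u ⁆ (x∈⁅x⁆ u)) (p⊆p∪q ⁅ u ⁆ w∈τ)) (proj₂ (∉∧⁻ {p = τ} {x = u} u∈lk))

  adjacent⇒link : u ≢ w → Adjacent w u → u ∈ linkVertices Δ ⁅ w ⁆
  adjacent⇒link u≢w wu∈Δ = ∈-tabulate⁺ (∉∧⁺ (x≢y⇒x∉⁅y⁆ u≢w) wu∈Δ)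

-- The double counting around a 4-face σ = {v₁,v₂,v₃,v₄}.
module FacetCount {n : ℕ} (Δ : SimplicialComplex n) (flag : IsFlag Δ) (pm : IsWeak3Pseudomanifold Δ)
  (v₁ v₂ v₃ v₄ : Fin n)
  (d₁₂ : v₁ ≢ v₂) (d₁₃ : v₁ ≢ v₃) (d₁₄ : v₁ ≢ v₄) (d₂₃ : v₂ ≢ v₃) (d₂₄ : v₂ ≢ v₄) (d₃₄ : v₃ ≢ v₄)
  (σ∈Δ : Face Δ (quad v₁ v₂ v₃ v₄)) where

  open SimplicialComplex Δ
  open ComplexFacts Δ

  σ : Subset n
  σ = quad v₁ v₂ v₃ v₄

  ∣σ∣≡4 : ∣ σ ∣ ≡ 4
  ∣σ∣≡4 = ∣quad∣ d₁₂ d₁₃ d₁₄ d₂₃ d₂₄ d₃₄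

  v₁∈σ : v₁ ∈ σ
  v₁∈σ = ∈-insert
  v₂∈σ : v₂ ∈ σ
  v₂∈σ = q⊆p∪q ⁅ v₁ ⁆ _ ∈-insert
  v₃∈σ : v₃ ∈ σ
  v₃∈σ = q⊆p∪q ⁅ v₁ ⁆ _ (q⊆p∪q ⁅ v₂ ⁆ _ ∈-insert)
  v₄∈σ : v₄ ∈ σ
  v₄∈σ = q⊆p∪q ⁅ v₁ ⁆ _ (q⊆p∪q ⁅ v₂ ⁆ _ (q⊆p∪q ⁅ v₃ ⁆ _ (x∈⁅x⁆ v₄)))

  S : ℕ
  S = f₀lk Δ (pair v₁ v₂) + f₀lk Δ (pair v₁ v₃) + f₀lk Δ (pair v₁ v₄)
    + f₀lk Δ (pair v₂ v₃) + f₀lk Δ (pair v₂ v₄) + f₀lk Δ (pair v₃ v₄)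

  edgeCount : Fin n → ℕ
  edgeCount u = ⟦ linkBit (pair v₁ v₂) u ⟧ + ⟦ linkBit (pair v₁ v₃) u ⟧ + ⟦ linkBit (pair v₁ v₄) u ⟧
              + ⟦ linkBit (pair v₂ v₃) u ⟧ + ⟦ linkBit (pair v₂ v₄) u ⟧ + ⟦ linkBit (pair v₃ v₄) u ⟧

  apexBit : Fin n → Fin n → Fin n → Fin n → Bool
  apexBit a b c u = not (lookup σ u) ∧ face (⁅ u ⁆ ∪ triangle a b c)

  apexCount : Fin n → ℕ
  apexCount u = ⟦ apexBit v₁ v₂ v₃ u ⟧ + ⟦ apexBit v₁ v₂ v₄ u ⟧
              + ⟦ apexBit v₁ v₃ v₄ u ⟧ + ⟦ apexBit v₂ v₃ v₄ u ⟧

  weight : Fin n → ℕ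
  weight u = ⟦ lookup σ u ⟧ + apexCount u

  S≡sum-edgeCount : S ≡ sum edgeCount
  S≡sum-edgeCount
    rewrite f₀lk≡sum (pair v₁ v₂) | f₀lk≡sum (pair v₁ v₃) | f₀lk≡sum (pair v₁ v₄)
          | f₀lk≡sum (pair v₂ v₃) | f₀lk≡sum (pair v₂ v₄) | f₀lk≡sum (pair v₃ v₄) =
    sym (∑-distrib₆ (⟦_⟧ ∘ linkBit (pair v₁ v₂)) (⟦_⟧ ∘ linkBit (pair v₁ v₃)) (⟦_⟧ ∘ linkBit (pair v₁ v₄))
                    (⟦_⟧ ∘ linkBit (pair v₂ v₃)) (⟦_⟧ ∘ linkBit (pair v₂ v₄)) (⟦_⟧ ∘ linkBit (pair v₃ v₄)))

  edgeCount-inside : ∀ {u} → u ∈ σ → edgeCount u ≤ 3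
  edgeCount-inside u∈σ = by-vertex (∈-quad⁻ u∈σ)
    where
    one : ∀ a b u → ⟦ linkBit (pair a b) u ⟧ ≤ 1
    one a b u = ⟦⟧≤1 (linkBit (pair a b) u)
    by-vertex : ∀ {u} → u ≡ v₁ ⊎ u ≡ v₂ ⊎ u ≡ v₃ ⊎ u ≡ v₄ → edgeCount u ≤ 3
    by-vertex (inj₁ refl) =
      +-mono-≤₆ (link-endpointˡ v₁ v₂) (link-endpointˡ v₁ v₃) (link-endpointˡ v₁ v₄)
                (one v₂ v₃ v₁) (one v₂ v₄ v₁) (one v₃ v₄ v₁)
    by-vertex (inj₂ (inj₁ refl)) =
      +-mono-≤₆ (link-endpointʳ v₁ v₂) (one v₁ v₃ v₂) (one v₁ v₄ v₂)
                (link-endpointˡ v₂ v₃) (link-endpointˡ v₂ v₄) (one v₃ v₄ v₂)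
    by-vertex (inj₂ (inj₂ (inj₁ refl))) =
      +-mono-≤₆ (one v₁ v₂ v₃) (link-endpointʳ v₁ v₃) (one v₁ v₄ v₃)
                (link-endpointʳ v₂ v₃) (one v₂ v₄ v₃) (link-endpointˡ v₃ v₄)
    by-vertex (inj₂ (inj₂ (inj₂ refl))) =
      +-mono-≤₆ (one v₁ v₂ v₄) (one v₁ v₃ v₄) (link-endpointʳ v₁ v₄)
                (one v₂ v₃ v₄) (link-endpointʳ v₂ v₄) (link-endpointʳ v₃ v₄)

  -- Outside σ: edge links force adjacency, and adjacent triples are apexes (flagness).
  edgeCount-outside : ∀ {u} → u ∉ σ → edgeCount u ≤ suc (apexCount u + apexCount u)
  edgeCount-outside {u} u∉σ =
    ≤-trans (+-mono-≤₆ (⟦⟧-mono (edge v₁ v₂)) (⟦⟧-mono (edge v₁ v₃)) (⟦⟧-mono (edge v₁ v₄))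
                       (⟦⟧-mono (edge v₂ v₃)) (⟦⟧-mono (edge v₂ v₄)) (⟦⟧-mono (edge v₃ v₄)))
    (≤-trans (choose₂≤1+2choose₃ (adj v₁) (adj v₂) (adj v₃) (adj v₄))
    (s≤s (+-mono-≤ triples≤apexCount triples≤apexCount)))
    where
    adj : Fin n → Bool
    adj a = face (pair u a)
    edge : ∀ a b → T (linkBit (pair a b) u) → T (adj a ∧ adj b)
    edge a b u∈lk = from T-∧ (link⇒adjacent u∈lk ∈-insert , link⇒adjacent u∈lk ∈-pairʳ)
    apex : ∀ {a b c} → a ∈ σ → b ∈ σ → c ∈ σ → T (adj a ∧ adj b ∧ adj c) → T (apexBit a b c u)
    apex {a} {b} {c} a∈σ b∈σ c∈σ t with to T-∧ t
    ... | ua , ubc with to T-∧ ubc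
    ... | ub , uc = ∉∧⁺ u∉σ (cone-face flag (down-closed (triangle-⊆ a∈σ b∈σ c∈σ) σ∈Δ) u~abc)
      where
      u~abc : ∀ {w} → w ∈ triangle a b c → Adjacent u w
      u~abc w∈ with ∈-triangle⁻ w∈
      ... | inj₁ refl = ua
      ... | inj₂ (inj₁ refl) = ub
      ... | inj₂ (inj₂ refl) = uc
    triples≤apexCount : choose₃ (adj v₁) (adj v₂) (adj v₃) (adj v₄) ≤ apexCount u
    triples≤apexCount = +-mono-≤₄ (⟦⟧-mono (apex v₁∈σ v₂∈σ v₃∈σ)) (⟦⟧-mono (apex v₁∈σ v₂∈σ v₄∈σ))
                                  (⟦⟧-mono (apex v₁∈σ v₃∈σ v₄∈σ)) (⟦⟧-mono (apex v₂∈σ v₃∈σ v₄∈σ))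

  local-bound : ∀ u → edgeCount u ≤ suc (weight u + weight u)
  local-bound u with u ∈? σ
  ... | yes u∈σ = ≤-trans (edgeCount-inside u∈σ) (s≤s (+-mono-≤ 1≤weight 1≤weight))
    where
    1≤weight : 1 ≤ weight u
    1≤weight = ≤-trans (≤-reflexive (sym (⟦lookup⟧-∈ u∈σ))) (m≤m+n _ (apexCount u))
  ... | no u∉σ = ≤-trans (edgeCount-outside u∉σ) (s≤s (+-mono-≤ apex≤weight apex≤weight))
    where
    apex≤weight : apexCount u ≤ weight u
    apex≤weight = m≤n+m (apexCount u) ⟦ lookup σ u ⟧

  apex-at-most-once : ∀ {a b c} → a ∈ σ → b ∈ σ → c ∈ σ → a ≢ b → a ≢ c → b ≢ c →
                      sum (λ u → ⟦ apexBit a b c u ⟧) ≤ 1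
  apex-at-most-once a∈σ b∈σ c∈σ a≢b a≢c b≢c = sum-at-most-one _ λ u∈ u′∈ →
    apex-unique pm σ∈Δ ∣σ∣≡4 (triangle-⊆ a∈σ b∈σ c∈σ) (∣triangle∣ a≢b a≢c b≢c)
      (proj₁ (∉∧⁻ {p = σ} u∈)) (proj₁ (∉∧⁻ {p = σ} u′∈)) (proj₂ (∉∧⁻ {p = σ} u∈)) (proj₂ (∉∧⁻ {p = σ} u′∈))

  weight-sum : sum weight ≤ 8
  weight-sum = begin
    sum weight                                            ≡⟨ ∑-distrib-+ (⟦_⟧ ∘ lookup σ) apexCount ⟩
    sum (⟦_⟧ ∘ lookup σ) + sum apexCount                  ≡⟨ cong₂ _+_ (trans (sym (∣p∣≡sum σ)) ∣σ∣≡4) ∑apex ⟩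
    4 + (sum (⟦_⟧ ∘ apexBit v₁ v₂ v₃) + sum (⟦_⟧ ∘ apexBit v₁ v₂ v₄)
         + sum (⟦_⟧ ∘ apexBit v₁ v₃ v₄) + sum (⟦_⟧ ∘ apexBit v₂ v₃ v₄))
      ≤⟨ +-monoʳ-≤ 4 (+-mono-≤₄ (apex-at-most-once v₁∈σ v₂∈σ v₃∈σ d₁₂ d₁₃ d₂₃)
                                (apex-at-most-once v₁∈σ v₂∈σ v₄∈σ d₁₂ d₁₄ d₂₄)
                                (apex-at-most-once v₁∈σ v₃∈σ v₄∈σ d₁₃ d₁₄ d₃₄)
                                (apex-at-most-once v₂∈σ v₃∈σ v₄∈σ d₂₃ d₂₄ d₃₄)) ⟩
    8                                                     ∎
    where
    open ≤-Reasoning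
    ∑apex = ∑-distrib₄ (⟦_⟧ ∘ apexBit v₁ v₂ v₃) (⟦_⟧ ∘ apexBit v₁ v₂ v₄)
                       (⟦_⟧ ∘ apexBit v₁ v₃ v₄) (⟦_⟧ ∘ apexBit v₂ v₃ v₄)

  bound-sum : sum (λ u → suc (weight u + weight u)) ≤ n + 16
  bound-sum = begin
    sum (λ u → 1 + (weight u + weight u))               ≡⟨ ∑-distrib-+ {n} (λ _ → 1) (λ u → weight u + weight u) ⟩
    sum {n} (λ _ → 1) + sum (λ u → weight u + weight u) ≡⟨ cong₂ _+_ (sum-ones n) (∑-distrib-+ weight weight) ⟩
    n + (sum weight + sum weight)                       ≤⟨ +-monoʳ-≤ n (+-mono-≤ weight-sum weight-sum) ⟩
    n + 16                                              ∎
    where open ≤-Reasoning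

  S≤n+16 : S ≤ n + 16
  S≤n+16 = ≤-trans (≤-reflexive S≡sum-edgeCount) (≤-trans (sum-mono local-bound) bound-sum)

  -- In the equality case no vertex has c(u) = 0, since the sum would drop strictly.
  tight⇒edgeCount≢0 : S ≡ n + 16 → ∀ u → edgeCount u ≢ 0
  tight⇒edgeCount≢0 tight u c≡0 = <-irrefl (trans (sym S≡sum-edgeCount) tight)
    (≤-trans (sum-mono-< edgeCount (λ u → suc (weight u + weight u)) local-bound u
                 (subst (_< suc (weight u + weight u)) (sym c≡0) (s≤s z≤n))) bound-sum)

  ridge-covers : S ≡ n + 16 → ∀ τ → τ ⊆ σ → ∣ τ ∣ ≡ 3 →
                 ∀ u → Σ (Fin n) λ w → w ∈ τ × u ∈ linkVertices Δ ⁅ w ⁆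
  ridge-covers tight τ τ⊆σ ∣τ∣≡3 u with u ∈? σ
  ... | yes u∈σ with other-element (subst (1 <_) (sym ∣τ∣≡3) (s≤s (s≤s z≤n))) u
  ...   | w , w∈τ , w≢u = w , w∈τ , adjacent⇒link (w≢u ∘ sym) (down-closed (pair-⊆ (τ⊆σ w∈τ) u∈σ) σ∈Δ)
  ridge-covers tight τ τ⊆σ ∣τ∣≡3 u | no u∉σ =
    [ via v₁∈σ v₂∈σ d₁₂ , [ via v₁∈σ v₃∈σ d₁₃ , [ via v₁∈σ v₄∈σ d₁₄ ,
    [ via v₂∈σ v₃∈σ d₂₃ , [ via v₂∈σ v₄∈σ d₂₄ , via v₃∈σ v₄∈σ d₃₄ ]′ ]′ ]′ ]′ ]′
      (some-true _ _ _ _ _ _ (tight⇒edgeCount≢0 tight u))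
    where
    -- u lies in the link of an edge {a, b} ⊆ σ, and τ contains a or b.
    via : ∀ {a b} → a ∈ σ → b ∈ σ → a ≢ b → T (linkBit (pair a b) u) →
          Σ (Fin n) λ w → w ∈ τ × u ∈ linkVertices Δ ⁅ w ⁆
    via a∈σ b∈σ a≢b u∈lk with meets-pair τ⊆σ (≤-reflexive (trans ∣σ∣≡4 (cong suc (sym ∣τ∣≡3)))) a∈σ b∈σ a≢b
    ... | inj₁ a∈τ = _ , a∈τ , adjacent⇒link (∉⇒≢ u∉σ a∈σ) (adjacent-sym (link⇒adjacent u∈lk ∈-insert))
    ... | inj₂ b∈τ = _ , b∈τ , adjacent⇒link (∉⇒≢ u∉σ b∈σ) (adjacent-sym (link⇒adjacent u∈lk ∈-pairʳ))

lemma5p2 : (n : ℕ) (Δ : SimplicialComplex n) →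
    IsFlag Δ → IsWeak3Pseudomanifold Δ →
    (v₁ v₂ v₃ v₄ : Fin n) →
    v₁ ≢ v₂ → v₁ ≢ v₃ → v₁ ≢ v₄ → v₂ ≢ v₃ → v₂ ≢ v₄ → v₃ ≢ v₄ →
    IsFacet Δ (quad v₁ v₂ v₃ v₄) →
    let S = f₀lk Δ (pair v₁ v₂) + f₀lk Δ (pair v₁ v₃) + f₀lk Δ (pair v₁ v₄)
          + f₀lk Δ (pair v₂ v₃) + f₀lk Δ (pair v₂ v₄) + f₀lk Δ (pair v₃ v₄)
    in (S ≤ n + 16)
       × (S ≡ n + 16 →
          ∀ (τ : Subset n) → τ ⊆ quad v₁ v₂ v₃ v₄ → ∣ τ ∣ ≡ 3 →
            ∀ (u : Fin n) → Σ (Fin n) λ w → w ∈ τ × u ∈ linkVertices Δ ⁅ w ⁆)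
lemma5p2 n Δ flag pm v₁ v₂ v₃ v₄ d₁₂ d₁₃ d₁₄ d₂₃ d₂₄ d₃₄ (σ∈Δ , _) = S≤n+16 , ridge-covers
  where open FacetCount Δ flag pm v₁ v₂ v₃ v₄ d₁₂ d₁₃ d₁₄ d₂₃ d₂₄ d₃₄ σ∈Δ
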